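{- If there exists a $\overline{w}$-balanced $(M,q-1)$-packing of size $n$, then there exists an $(n,2w-1,\overline{w})_q$-code of size $M$.
   Context: $\overline{w}=(w_1,\ldots,w_{q-1})$ is a composition (positive, non-increasing components, total weight $w$); an $(n,d,\overline{w})_q$-code is a $q$-ary code of length $n$, minimum Hamming distance $d$, in which every codeword has exactly $w_i$ coordinates equal to $i$ for each $i$. Let $\lambda=\lceil w/w_1\rceil$. A $\overline{w}$-balanced $(M,q-1)$-packing of size $n$ is a pair $(\mathbb{Z}_M,\mathcal{A})$ where $\mathcal{A}=\{A_c: c\in[n]\}$ consists of $n$ tuples $A_c\in(\mathbb{Z}_M\cup\{*\})^{q-1}$ such that (T1) in each $A_c$ the entries other than $*$ are distinct, and the sets $B_c$ of non-$*$ entries form an $(M,\{\lambda,\lambda-1\})$-packing of size $n$ on $\mathbb{Z}_M$ (each $B_c$ has size $\lambda$ or $\lambda-1$, and every pair of elements of $\mathbb{Z}_M$ lies in at most one $B_c$); and (T2) for each position $i\in[q-1]$, each element of $\mathbb{Z}_M$ occurs in position $i$ exactly $w_i$ times over all tuples of $\mathcal{A}$. -}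

module Defs where

import Agda.Primitive

open import Data.Nat using (ℕ; zero; suc; _+_; _*_; _∸_; _≤_; _<_; _/_)
open import Data.Fin using (Fin; zero; suc) renaming (_≤_ to _≤ᶠ_)
open import Data.Fin.Properties using (_≟_)
open import Data.List using (List; length; filter; map)
open import Data.Nat.ListAction using (sum)
open import Data.Maybe.Properties using (≡-dec)
open import Data.List.Base using (allFin)
open import Data.Maybe using (Maybe; just; nothing)
open import Data.Product using (_×_; ∃; _,_)
open import Data.Sum using (_⊎_)
open import Relation.Nullary using (¬_; Dec)
open import Relation.Nullary.Decidable using (¬?)
open import Relation.Unary using (Pred; Decidable)
open import Relation.Binary.PropositionalEquality using (_≡_; _≢_)

countFin : ∀ {n} {P : Pred (Fin n) Agda.Primitive.lzero} → Decidable P → ℕ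
countFin {n} P? = length (filter P? (allFin n))

-- ceiling division ⌈ a / b ⌉ (b = 0 gives 0; never used since w₁ > 0)
ceilDiv : ℕ → ℕ → ℕ
ceilDiv a zero = 0
ceilDiv a (suc b) = (a + b) / suc b

-- Compositions.  We write q - 1 = suc k (so q = suc (suc k) ≥ 2);
-- a composition w̄ = (w₁,…,w_{q-1}) is a function Fin (suc k) → ℕ,
-- position 0 being w₁.

IsComposition : (k : ℕ) → (Fin (suc k) → ℕ) → Set
IsComposition k w =
  (∀ i → 0 < w i) × (∀ i j → i ≤ᶠ j → w j ≤ w i)

totalWeight : (k : ℕ) → (Fin (suc k) → ℕ) → ℕ
totalWeight k w = sum (map w (allFin (suc k)))

lam : (k : ℕ) → (Fin (suc k) → ℕ) → ℕ
lam k w = ceilDiv (totalWeight k w) (w zero)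

-- Codes over the alphabet Fin q = {0,…,q-1}, q = suc (suc k).
-- Symbol i ∈ [q-1] is  suc p  for p : Fin (suc k) (p = i - 1).

Word : (k n : ℕ) → Set
Word k n = Fin n → Fin (suc (suc k))

hammingDist : ∀ {k n} → Word k n → Word k n → ℕ
hammingDist x y = countFin (λ c → ¬? (x c ≟ y c))

HasComposition : ∀ {k n} → (Fin (suc k) → ℕ) → Word k n → Set
HasComposition {k} {n} w x = ∀ (p : Fin (suc k)) → countFin (λ c → x c ≟ suc p) ≡ w p

IsCWCode : (k n d : ℕ) → (w : Fin (suc k) → ℕ) → (M : ℕ) → (Fin M → Word k n) → Set
IsCWCode k n d w M C =
  (∀ a → HasComposition w (C a)) ×
  (∀ a b → a ≢ b → d ≤ hammingDist (C a) (C b))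

-- w̄-balanced (M, q-1)-packings of size n.
-- A tuple A_c ∈ (Z_M ∪ {*})^{q-1} is  Fin (suc k) → Maybe (Fin M),
-- with * = nothing; Z_M is represented by its underlying set Fin M.

Tuple : (k M : ℕ) → Set
Tuple k M = Fin (suc k) → Maybe (Fin M)

-- x ∈ B_c  (B_c = set of non-* entries of A_c)
InBlock : ∀ {k M} → Fin M → Tuple k M → Set
InBlock x A = ∃ λ i → A i ≡ just x

isJust? : ∀ {M} → (m : Maybe (Fin M)) → Dec (∃ λ x → m ≡ just x)
isJust? nothing = Relation.Nullary.no (λ { (_ , ()) })
isJust? (just x) = Relation.Nullary.yes (x , _≡_.refl)

-- |B_c| (= number of non-* positions, given distinctness (T1))
blockSize : ∀ {k M} → Tuple k M → ℕ
blockSize A = countFin (λ i → isJust? (A i))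

IsBalancedPacking : (k M n : ℕ) → (w : Fin (suc k) → ℕ) → (Fin n → Tuple k M) → Set
IsBalancedPacking k M n w A =
  (∀ c i j x → A c i ≡ just x → A c j ≡ just x → i ≡ j) ×
  (∀ c → blockSize (A c) ≡ lam k w ⊎ blockSize (A c) ≡ lam k w ∸ 1) ×
  (∀ c c' x y → x ≢ y → InBlock x (A c) → InBlock y (A c) →
     InBlock x (A c') → InBlock y (A c') → c ≡ c') ×
  (∀ (i : Fin (suc k)) (x : Fin M) → countFin (λ c → ≡-dec _≟_ (A c i) (just x)) ≡ w i)

-- Given a w̄-balanced (M, q-1)-packing (A_c)_{c ∈ [n]}, the codeword of
-- x ∈ Z_M has symbol i at coordinate c when x sits in position i of A_c,
-- and symbol 0 when x ∉ B_c.  Condition (T2) says exactly that this word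
-- has composition w̄, hence support of size w.  For x ≠ y the two words
-- never share a nonzero symbol (A_c cannot hold x and y in the same
-- position) and their supports meet in at most one coordinate (two blocks
-- share at most one pair).  Hence they differ on the whole union of their
-- supports, which has at least w + w - 1 elements.
module Submission where

open import Defs
open import Data.Nat using (ℕ; suc; _*_; _∸_)
open import Data.Fin using (Fin)
open import Data.Product using (∃; _×_)

open import Agda.Primitive using (lzero)
open import Data.Nat using (zero; _+_; _≤_; z≤n; s≤s)
open import Data.Nat.Properties
  using (+-mono-≤; ≤-refl; ≤-reflexive; ∸-monoˡ-≤; m+n∸n≡m; +-identityʳ; +-0-commutativeMonoid)
import Data.Nat.Properties as ℕ
open import Data.Nat.ListAction using (sum)
open import Data.Fin using (zero; suc)
open import Data.Fin.Properties using (_≟_; any?; suc-injective)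
open import Data.Maybe using (just)
open import Data.Maybe.Properties using (≡-dec; just-injective)
open import Data.List using (length; filter; tabulate)
open import Data.List.Properties using (map-tabulate)
open import Data.Product using (_,_; proj₁; proj₂)
open import Data.Empty using (⊥-elim)
open import Relation.Nullary using (Dec; yes; no; ¬_)
open import Relation.Nullary.Decidable using (¬?; _×-dec_)
open import Relation.Unary using (Pred; Decidable)
open import Relation.Binary.PropositionalEquality
open import Function using (_∘_; id)
open import Algebra.Properties.CommutativeMonoid.Sum +-0-commutativeMonoid
  using (sum-syntax; ∑-distrib-+; ∑-comm; sum-cong-≗; sum-replicate-zero)
  renaming (sum to ∑)

𝟙 : ∀ {a} {P : Set a} → Dec P → ℕ
𝟙 (yes _) = 1
𝟙 (no _)  = 0

𝟙-yes : ∀ {a} {P : Set a} (P? : Dec P) → P → 𝟙 P? ≡ 1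
𝟙-yes (yes _) _  = refl
𝟙-yes (no ¬p) p = ⊥-elim (¬p p)

𝟙-no : ∀ {a} {P : Set a} (P? : Dec P) → ¬ P → 𝟙 P? ≡ 0
𝟙-no (yes p) ¬p = ⊥-elim (¬p p)
𝟙-no (no _)  _  = refl

𝟙-cong : ∀ {a b} {P : Set a} {Q : Set b} (P? : Dec P) (Q? : Dec Q) →
  (P → Q) → (Q → P) → 𝟙 P? ≡ 𝟙 Q?
𝟙-cong (yes p) Q? to from = sym (𝟙-yes Q? (to p))
𝟙-cong (no ¬p) Q? to from = sym (𝟙-no Q? (¬p ∘ from))

length-filter-tabulate : ∀ {A : Set} {n} {P : Pred A lzero} (P? : Decidable P) (g : Fin n → A) →
  length (filter P? (tabulate g)) ≡ ∑[ i < n ] 𝟙 (P? (g i))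
length-filter-tabulate {n = zero}  P? g = refl
length-filter-tabulate {n = suc n} P? g with P? (g zero)
... | yes _ = cong suc (length-filter-tabulate P? (g ∘ suc))
... | no _  = length-filter-tabulate P? (g ∘ suc)

countFin≡∑𝟙 : ∀ {n} {P : Pred (Fin n) lzero} (P? : Decidable P) →
  countFin P? ≡ ∑[ i < n ] 𝟙 (P? i)
countFin≡∑𝟙 P? = length-filter-tabulate P? id

sum-tabulate : ∀ {n} (f : Fin n → ℕ) → sum (tabulate f) ≡ ∑[ i < n ] f i
sum-tabulate {zero}  f = refl
sum-tabulate {suc n} f = cong (f zero +_) (sum-tabulate (f ∘ suc))

totalWeight≡∑ : ∀ k (w : Fin (suc k) → ℕ) → totalWeight k w ≡ ∑[ p < suc k ] w p
totalWeight≡∑ k w = trans (cong sum (map-tabulate id w)) (sum-tabulate w)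

∑-mono-≤ : ∀ {n} {f g : Fin n → ℕ} → (∀ i → f i ≤ g i) → ∑ f ≤ ∑ g
∑-mono-≤ {zero}  f≤g = z≤n
∑-mono-≤ {suc n} f≤g = +-mono-≤ (f≤g zero) (∑-mono-≤ (f≤g ∘ suc))

∑𝟙-atMostOne : ∀ {n} {P : Pred (Fin n) lzero} (P? : Decidable P) →
  (∀ i j → P i → P j → i ≡ j) → ∑[ i < n ] 𝟙 (P? i) ≤ 1
∑𝟙-atMostOne {zero}  P? unique = z≤n
∑𝟙-atMostOne {suc n} P? unique with P? zero
... | no _  = ∑𝟙-atMostOne (P? ∘ suc) (λ i j pi pj → suc-injective (unique _ _ pi pj))
... | yes p = ≤-reflexive (cong suc (trans (sum-cong-≗ none) (sum-replicate-zero n)))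
  where
  none : ∀ i → 𝟙 (P? (suc i)) ≡ 0
  none i = 𝟙-no (P? (suc i)) (λ q → zero≢suc (unique _ _ p q))
    where
    zero≢suc : ¬ (Fin.zero ≡ suc i)
    zero≢suc ()

nonzero : ∀ {m} → Fin (suc m) → ℕ
nonzero u = 𝟙 (¬? (u ≟ zero))

∑𝟙-≟    : ∀ {m} (v : Fin m) → ∑[ p < m ] 𝟙 (v ≟ p) ≡ 1
∑𝟙-≟suc : ∀ {m} (u : Fin (suc m)) → ∑[ p < m ] 𝟙 (u ≟ suc p) ≡ nonzero u

∑𝟙-≟ {suc m} v = trans (cong (𝟙 (v ≟ zero) +_) (∑𝟙-≟suc v)) (zeroOrNonzero v)
  where
  zeroOrNonzero : (v : Fin (suc m)) → 𝟙 (v ≟ zero) + nonzero v ≡ 1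
  zeroOrNonzero zero    = refl
  zeroOrNonzero (suc _) = refl

∑𝟙-≟suc {m} zero =
  trans (sum-cong-≗ {m} (λ p → 𝟙-no (zero ≟ suc p) λ ())) (sum-replicate-zero m)
∑𝟙-≟suc (suc v) = trans (sum-cong-≗ shift) (∑𝟙-≟ v)
  where
  shift : ∀ p → 𝟙 (suc v ≟ suc p) ≡ 𝟙 (v ≟ p)
  shift p = 𝟙-cong (suc v ≟ suc p) (v ≟ p) suc-injective (cong suc)

-- A word of composition w̄ has support of size w: split the support by
-- symbol and exchange the two sums.
support-size : ∀ {k n} (w : Fin (suc k) → ℕ) (x : Word k n) → HasComposition w x →
  ∑[ c < n ] nonzero (x c) ≡ totalWeight k w
support-size {k} {n} w x comp = begin
  ∑[ c < n ] nonzero (x c)                      ≡⟨ sum-cong-≗ (sym ∘ ∑𝟙-≟suc ∘ x) ⟩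
  ∑[ c < n ] ∑[ p < suc k ] 𝟙 (x c ≟ suc p)     ≡⟨ ∑-comm (λ c p → 𝟙 (x c ≟ suc p)) ⟩
  ∑[ p < suc k ] ∑[ c < n ] 𝟙 (x c ≟ suc p)     ≡⟨ sum-cong-≗ byComposition ⟩
  ∑[ p < suc k ] w p                            ≡⟨ sym (totalWeight≡∑ k w) ⟩
  totalWeight k w                               ∎
  where
  open ≡-Reasoning
  byComposition : ∀ p → ∑[ c < n ] 𝟙 (x c ≟ suc p) ≡ w p
  byComposition p = trans (sym (countFin≡∑𝟙 (λ c → x c ≟ suc p))) (comp p)

bothNonzero? : ∀ {m} (u v : Fin (suc m)) → Dec (¬ u ≡ zero × ¬ v ≡ zero)
bothNonzero? u v = ¬? (u ≟ zero) ×-dec ¬? (v ≟ zero)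

-- Pointwise form of the distance bound: symbols that do not agree on a
-- nonzero value differ wherever one of them is nonzero, and the only
-- double count is where both are nonzero.
nonzero-pair-≤ : ∀ {m} (u v : Fin (suc m)) → (u ≡ v → u ≡ zero) →
  nonzero u + nonzero v ≤ 𝟙 (¬? (u ≟ v)) + 𝟙 (bothNonzero? u v)
nonzero-pair-≤ zero    zero    _ = z≤n
nonzero-pair-≤ zero    (suc j) _ = s≤s z≤n
nonzero-pair-≤ (suc i) zero    _ = s≤s z≤n
nonzero-pair-≤ (suc i) (suc j) agreeOnlyOnZero =
  ≤-reflexive (cong (_+ 1) (sym (𝟙-yes (¬? (suc i ≟ suc j)) differ)))
  where
  differ : ¬ suc i ≡ suc j
  differ eq with () ← agreeOnlyOnZero eq

support-distance-bound : ∀ {k n} (x y : Word k n) → (∀ c → x c ≡ y c → x c ≡ zero) →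
  ∑[ c < n ] nonzero (x c) + ∑[ c < n ] nonzero (y c)
    ≤ hammingDist x y + ∑[ c < n ] 𝟙 (bothNonzero? (x c) (y c))
support-distance-bound {n = n} x y agreeOnlyOnZero = begin
  ∑[ c < n ] nonzero (x c) + ∑[ c < n ] nonzero (y c)  ≡⟨ sym (∑-distrib-+ (nonzero ∘ x) (nonzero ∘ y)) ⟩
  ∑[ c < n ] (nonzero (x c) + nonzero (y c))           ≤⟨ ∑-mono-≤ pointwise ⟩
  ∑[ c < n ] (𝟙 (¬? (x c ≟ y c)) + 𝟙 (bothNonzero? (x c) (y c)))
                                                        ≡⟨ ∑-distrib-+ differ both ⟩
  ∑[ c < n ] 𝟙 (¬? (x c ≟ y c)) + ∑[ c < n ] 𝟙 (bothNonzero? (x c) (y c))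
                                                        ≡⟨ cong (_+ ∑ both) (sym (countFin≡∑𝟙 (λ c → ¬? (x c ≟ y c)))) ⟩
  hammingDist x y + ∑[ c < n ] 𝟙 (bothNonzero? (x c) (y c)) ∎
  where
  open ℕ.≤-Reasoning
  differ both : Fin n → ℕ
  differ c = 𝟙 (¬? (x c ≟ y c))
  both   c = 𝟙 (bothNonzero? (x c) (y c))
  pointwise : ∀ c → nonzero (x c) + nonzero (y c) ≤ differ c + both c
  pointwise c = nonzero-pair-≤ (x c) (y c) (agreeOnlyOnZero c)

-- Numerical consequence: supports of size w meeting in at most one
-- coordinate force distance at least 2w - 1.
distance-from-supports : ∀ W {d s} → W + W ≤ d + s → s ≤ 1 → 2 * W ∸ 1 ≤ d
distance-from-supports W {d} {s} bound s≤1 = begin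
  2 * W ∸ 1      ≡⟨ cong (λ t → W + t ∸ 1) (+-identityʳ W) ⟩
  W + W ∸ 1      ≤⟨ ∸-monoˡ-≤ 1 (ℕ.≤-trans bound (+-mono-≤ (≤-refl {d}) s≤1)) ⟩
  d + 1 ∸ 1      ≡⟨ m+n∸n≡m d 1 ⟩
  d              ∎
  where open ℕ.≤-Reasoning

module PackingCode {k M n : ℕ} {w : Fin (suc k) → ℕ} (A : Fin n → Tuple k M)
  (packing : IsBalancedPacking k M n w A) where

  distinctEntries : ∀ c i j x → A c i ≡ just x → A c j ≡ just x → i ≡ j
  distinctEntries = proj₁ packing

  pairsInOneBlock : ∀ c c′ x y → x ≢ y → InBlock x (A c) → InBlock y (A c) →
    InBlock x (A c′) → InBlock y (A c′) → c ≡ c′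
  pairsInOneBlock = proj₁ (proj₂ (proj₂ packing))

  balanced : ∀ p x → countFin (λ c → ≡-dec _≟_ (A c p) (just x)) ≡ w p
  balanced = proj₂ (proj₂ (proj₂ packing))

  inBlock? : ∀ x c → Dec (InBlock x (A c))
  inBlock? x c = any? (λ i → ≡-dec _≟_ (A c i) (just x))

  symbol : ∀ {x : Fin M} {T : Tuple k M} → Dec (InBlock x T) → Fin (suc (suc k))
  symbol (yes (i , _)) = suc i
  symbol (no _)        = zero

  codeword : Fin M → Word k n
  codeword x c = symbol (inBlock? x c)

  -- The codeword of x shows symbol suc p at c exactly when x is in
  -- position p of A_c; the converse direction needs distinctness (T1).
  symbol-sound : ∀ {x c p} (x∈? : Dec (InBlock x (A c))) → symbol x∈? ≡ suc p → A c p ≡ just x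
  symbol-sound (yes (i , eq)) refl = eq
  symbol-sound (no _)         ()

  symbol-complete : ∀ {x c p} (x∈? : Dec (InBlock x (A c))) → A c p ≡ just x → symbol x∈? ≡ suc p
  symbol-complete {x} {c} {p} (yes (i , eq)) eq′ = cong suc (distinctEntries c i p x eq eq′)
  symbol-complete {p = p}     (no x∉)        eq′ = ⊥-elim (x∉ (p , eq′))

  symbol-nonzero : ∀ {x c} (x∈? : Dec (InBlock x (A c))) → ¬ symbol x∈? ≡ zero → InBlock x (A c)
  symbol-nonzero (yes x∈) _   = x∈
  symbol-nonzero (no _)   nz = ⊥-elim (nz refl)

  codeword-composition : ∀ x → HasComposition w (codeword x)
  codeword-composition x p = begin
    countFin (λ c → codeword x c ≟ suc p)          ≡⟨ countFin≡∑𝟙 (λ c → codeword x c ≟ suc p) ⟩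
    ∑[ c < n ] 𝟙 (codeword x c ≟ suc p)            ≡⟨ sum-cong-≗ sameIndicator ⟩
    ∑[ c < n ] 𝟙 (≡-dec _≟_ (A c p) (just x))      ≡⟨ sym (countFin≡∑𝟙 (λ c → ≡-dec _≟_ (A c p) (just x))) ⟩
    countFin (λ c → ≡-dec _≟_ (A c p) (just x))    ≡⟨ balanced p x ⟩
    w p                                            ∎
    where
    open ≡-Reasoning
    sameIndicator : ∀ c → 𝟙 (codeword x c ≟ suc p) ≡ 𝟙 (≡-dec _≟_ (A c p) (just x))
    sameIndicator c = 𝟙-cong _ _ (symbol-sound (inBlock? x c)) (symbol-complete (inBlock? x c))

  -- Distinct points never occupy the same position of a tuple.
  agree-only-on-zero : ∀ {x y} → x ≢ y → ∀ c → codeword x c ≡ codeword y c → codeword x c ≡ zero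
  agree-only-on-zero {x} {y} x≢y c same = bySymbol (codeword x c) refl
    where
    bySymbol : ∀ u → codeword x c ≡ u → codeword x c ≡ zero
    bySymbol zero    eq = eq
    bySymbol (suc p) eq = ⊥-elim (x≢y (just-injective (begin
      just x       ≡⟨ sym (symbol-sound (inBlock? x c) eq) ⟩
      A c p        ≡⟨ symbol-sound (inBlock? y c) (trans (sym same) eq) ⟩
      just y       ∎)))
      where open ≡-Reasoning

  -- Distinct points lie in a common block at most once (T1, packing).
  common-support-≤1 : ∀ {x y} → x ≢ y →
    ∑[ c < n ] 𝟙 (bothNonzero? (codeword x c) (codeword y c)) ≤ 1
  common-support-≤1 {x} {y} x≢y =
    ∑𝟙-atMostOne (λ c → bothNonzero? (codeword x c) (codeword y c)) λ c c′ (x∈c , y∈c) (x∈c′ , y∈c′) →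
    pairsInOneBlock c c′ x y x≢y
      (symbol-nonzero (inBlock? x c) x∈c)   (symbol-nonzero (inBlock? y c) y∈c)
      (symbol-nonzero (inBlock? x c′) x∈c′) (symbol-nonzero (inBlock? y c′) y∈c′)

proposition10 : (k : ℕ) (w : Fin (suc k) → ℕ) (M n : ℕ) →
    IsComposition k w →
    (∃ λ (A : Fin n → Tuple k M) → IsBalancedPacking k M n w A) →
    ∃ λ (C : Fin M → Word k n) → IsCWCode k n (2 * totalWeight k w ∸ 1) w M C
proposition10 k w M n _ (A , packing) = codeword , codeword-composition , distance
  where
  open PackingCode A packing

  distance : ∀ x y → x ≢ y → 2 * totalWeight k w ∸ 1 ≤ hammingDist (codeword x) (codeword y)
  distance x y x≢y = distance-from-supports (totalWeight k w) supportBound (common-support-≤1 x≢y)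
    where
    common : ℕ
    common = ∑[ c < n ] 𝟙 (bothNonzero? (codeword x c) (codeword y c))
    supportBound : totalWeight k w + totalWeight k w ≤ hammingDist (codeword x) (codeword y) + common
    supportBound = subst₂ (λ a b → a + b ≤ hammingDist (codeword x) (codeword y) + common)
      (support-size w (codeword x) (codeword-composition x))
      (support-size w (codeword y) (codeword-composition y))
      (support-distance-bound (codeword x) (codeword y) (agree-only-on-zero x≢y))
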